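{- For every integer $n\geq 2$ we have $C_{\mathbb Z_n',\{1\}}(n)=4$.
   Context: $\mathbb Z_n=\mathbb Z/n\mathbb Z$ as a module over itself and $\mathbb Z_n'=\mathbb Z_n\setminus\{0\}$. For non-empty $A,B\subseteq\mathbb Z_n$, a sequence $(x_1,\ldots,x_k)$ is an $(A,B)$-weighted zero-sum sequence if there exist $a_i\in A$, $b_i\in B$ with $\sum a_ix_i=0$ and $\sum b_ia_i=0$. $C_{A,B}(n)$ is the least positive $k$ such that every sequence in $\mathbb Z_n$ of length $k$ has an $(A,B)$-weighted zero-sum subsequence having consecutive terms, i.e. a non-empty block $(x_i,\ldots,x_j)$. -}

module Defs where

open import Level using (Level; 0ℓ)
open import Data.Nat using (ℕ; zero; suc; _+_; _*_; _≤_; _<_)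
open import Data.Nat.Divisibility using (_∣_)
open import Data.Fin using (Fin; toℕ)
open import Data.List using (List; []; _∷_; _++_; length; map; zipWith)
open import Data.Nat.ListAction using (sum)
open import Data.List.Relation.Unary.All using (All)
open import Data.Product using (Σ; ∃; ∃-syntax; _×_; _,_)
open import Relation.Binary.PropositionalEquality using (_≡_; _≢_)
open import Relation.Nullary using (¬_)

-- Elements of ℤ_n are represented by Fin n (canonical residues 0..n-1);
-- an equation  Σ c_i = 0  in ℤ_n  is expressed as  n ∣ Σ toℕ-representatives.

dot : ∀ {n} → List (Fin n) → List (Fin n) → ℕ
dot as xs = sum (zipWith (λ a x → toℕ a * toℕ x) as xs)

WeightedZeroSum : (n : ℕ) (A B : Fin n → Set) → List (Fin n) → Set
WeightedZeroSum n A B xs =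
  Σ (List (Fin n)) λ as → Σ (List (Fin n)) λ bs →
    (length as ≡ length xs) × (length bs ≡ length xs) ×
    All A as × All B bs ×
    (n ∣ dot as xs) × (n ∣ dot bs as)

HasConsecutiveWZS : (n : ℕ) (A B : Fin n → Set) → List (Fin n) → Set
HasConsecutiveWZS n A B xs =
  ∃[ pre ] ∃[ blk ] ∃[ suf ]
    (xs ≡ pre ++ blk ++ suf) × (1 ≤ length blk) × WeightedZeroSum n A B blk

Property : (n : ℕ) (A B : Fin n → Set) → ℕ → Set
Property n A B k = (xs : List (Fin n)) → length xs ≡ k → HasConsecutiveWZS n A B xs

IsC : (n : ℕ) (A B : Fin n → Set) → ℕ → Set
IsC n A B k =
  (1 ≤ k) × Property n A B k × (∀ m → 1 ≤ m → m < k → ¬ Property n A B m)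

-- ℤ_n' = ℤ_n ∖ {0}
Nonzero : (n : ℕ) → Fin n → Set
Nonzero n a = toℕ a ≢ 0

-- the singleton {1} ⊆ ℤ_n (for n ≥ 2 the residue 1 is represented by toℕ b ≡ 1)
One : (n : ℕ) → Fin n → Set
One n b = toℕ b ≡ 1

-- Four terms suffice: a sequence of length 4 either has two equal adjacent
-- terms x, x (weights 1, −1), or three consecutive pairwise distinct terms
-- x, y, z (weights y − z, z − x, x − y), or is of the form x, y, x, y
-- (weights 1, 1, −1, −1); in each case the weights are nonzero and sum to 0.
-- Three do not: no block of 0, 1, 0 is weighted zero-sum, since a singleton
-- would need a nonzero weight summing to 0, and any other block has weighted
-- sum equal to the weight on its single 1.
module Submission where

open import Defs
open import Data.Nat using (ℕ; suc; _+_; _*_; _∸_; _≤_; _<_; z≤n; s≤s; NonZero; ≢-nonZero)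
open import Data.Nat.Properties
  using (*-comm; *-identityˡ; *-identityʳ; +-identityʳ; +-assoc; +-comm; <⇒≤; n<1+n; m∸n+n≡m)
open import Data.Nat.DivMod
  using (_%_; _/_; m%n<n; m≡m%n+[m/n]*n; m<n⇒m%n≡m; [m+n]%n≡m%n; [m+kn]%n≡m%n)
open import Data.Nat.Divisibility
  using (_∣_; _∤_; divides; ∣-refl; m%n≡0⇒n∣m; ∣m∣n⇒∣m+n; ∣m+n∣m⇒∣n; n∣m*n; m∣m*n; >⇒∤)
open import Data.Nat.ListAction using (sum)
open import Data.Nat.Tactic.RingSolver using (solve-∀)
open import Data.Fin as Fin using (Fin; toℕ; fromℕ<; _≟_)
open import Data.Fin.Properties using (toℕ-fromℕ<; toℕ<n; toℕ-injective)
open import Data.List using (List; []; _∷_; _++_; length; map; replicate; zipWith)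
open import Data.List.Properties using (length-map; length-replicate; zipWith-comm; ++-assoc)
open import Data.List.Relation.Unary.All as All using (All; []; _∷_)
open import Data.List.Relation.Unary.All.Properties using (map⁺; replicate⁺)
open import Data.Product using (_,_)
open import Relation.Nullary using (¬_; yes; no)
open import Relation.Binary.PropositionalEquality

dot-comm : ∀ {n} (as xs : List (Fin n)) → dot as xs ≡ dot xs as
dot-comm as xs = cong sum (zipWith-comm _ (λ a x → *-comm (toℕ a) (toℕ x)) as xs)

nonzero⇒∤ : ∀ {n} {a : Fin n} → Nonzero n a → n ∤ toℕ a
nonzero⇒∤ {a = a} a≢0 = >⇒∤ {{≢-nonZero a≢0}} (toℕ<n a)

∣+∸⇒≡ : ∀ {n y z} .{{_ : NonZero n}} → y < n → z < n → n ∣ y + (n ∸ z) → y ≡ z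
∣+∸⇒≡ {n} {y} {z} y<n z<n (divides q y+[n∸z]≡qn) = begin
  y                ≡⟨ m<n⇒m%n≡m y<n ⟨
  y % n            ≡⟨ [m+n]%n≡m%n y n ⟨
  (y + n) % n      ≡⟨ cong (_% n) y+n≡z+qn ⟩
  (z + q * n) % n  ≡⟨ [m+kn]%n≡m%n z q n ⟩
  z % n            ≡⟨ m<n⇒m%n≡m z<n ⟩
  z                ∎
  where
  open ≡-Reasoning
  y+n≡z+qn : y + n ≡ z + q * n
  y+n≡z+qn = begin
    y + n            ≡⟨ cong (y +_) (m∸n+n≡m (<⇒≤ z<n)) ⟨
    y + (n ∸ z + z)  ≡⟨ +-assoc y (n ∸ z) z ⟨
    y + (n ∸ z) + z  ≡⟨ cong (_+ z) y+[n∸z]≡qn ⟩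
    q * n + z        ≡⟨ +-comm (q * n) z ⟩
    z + q * n        ∎

HasConsecutiveWZS-++ʳ : ∀ {n A B} xs ys →
  HasConsecutiveWZS n A B xs → HasConsecutiveWZS n A B (xs ++ ys)
HasConsecutiveWZS-++ʳ _ ys (pre , blk , suf , refl , 1≤∣blk∣ , wzs) =
  pre , blk , suf ++ ys , shift , 1≤∣blk∣ , wzs
  where
  shift : (pre ++ blk ++ suf) ++ ys ≡ pre ++ blk ++ suf ++ ys
  shift = trans (++-assoc pre (blk ++ suf) ys) (cong (pre ++_) (++-assoc blk suf ys))

module Residues (n : ℕ) {{_ : NonZero n}} where

  residue : ℕ → Fin n
  residue v = fromℕ< (m%n<n v n)

  toℕ-residue : ∀ v → toℕ (residue v) ≡ v % n
  toℕ-residue v = toℕ-fromℕ< (m%n<n v n)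

  residue≢0 : ∀ {v} → n ∤ v → Nonzero n (residue v)
  residue≢0 {v} n∤v v%n≡0 = n∤v (m%n≡0⇒n∣m v n (trans (sym (toℕ-residue v)) v%n≡0))

  weightedSum : List ℕ → List (Fin n) → ℕ
  weightedSum vs xs = sum (zipWith (λ v x → v * toℕ x) vs xs)

  weightedSum-divMod : ∀ vs xs →
    weightedSum (map (_/ n) vs) xs * n + dot (map residue vs) xs ≡ weightedSum vs xs
  weightedSum-divMod []       _        = refl
  weightedSum-divMod (v ∷ vs) []       = refl
  weightedSum-divMod (v ∷ vs) (x ∷ xs) = begin
    (v / n * X + Q) * n + (toℕ (residue v) * X + D)
      ≡⟨ cong (λ r → (v / n * X + Q) * n + (r * X + D)) (toℕ-residue v) ⟩
    (v / n * X + Q) * n + (v % n * X + D)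
      ≡⟨ regroup (v % n) (v / n) X Q D n ⟩
    (v % n + v / n * n) * X + (Q * n + D)
      ≡⟨ cong₂ (λ u w → u * X + w) (sym (m≡m%n+[m/n]*n v n)) (weightedSum-divMod vs xs) ⟩
    v * X + weightedSum vs xs ∎
    where
    open ≡-Reasoning
    X = toℕ x
    Q = weightedSum (map (_/ n) vs) xs
    D = dot (map residue vs) xs
    regroup : ∀ r q X Q D n → (q * X + Q) * n + (r * X + D) ≡ (r + q * n) * X + (Q * n + D)
    regroup = solve-∀

  ∣-dot-residue : ∀ vs xs → n ∣ weightedSum vs xs → n ∣ dot (map residue vs) xs
  ∣-dot-residue vs xs n∣weightedSum =
    ∣m+n∣m⇒∣n (subst (n ∣_) (sym (weightedSum-divMod vs xs)) n∣weightedSum)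
              (n∣m*n (weightedSum (map (_/ n) vs) xs))

module ZeroSumBlocks (k : ℕ) where

  N : ℕ
  N = suc (suc k)

  open Residues N

  WZS : List (Fin N) → Set
  WZS = WeightedZeroSum N (Nonzero N) (One N)

  HasWZSBlock : List (Fin N) → Set
  HasWZSBlock = HasConsecutiveWZS N (Nonzero N) (One N)

  one : Fin N
  one = Fin.suc Fin.zero

  weightedSum-ones : ∀ vs → weightedSum vs (replicate (length vs) one) ≡ sum vs
  weightedSum-ones []       = refl
  weightedSum-ones (v ∷ vs) = cong₂ _+_ (*-identityʳ v) (weightedSum-ones vs)

  wzs-by-residues : ∀ vs xs → length vs ≡ length xs → All (N ∤_) vs →
    N ∣ weightedSum vs xs → N ∣ sum vs → WZS xs
  wzs-by-residues vs xs ∣vs∣≡∣xs∣ N∤vs N∣weightedSum N∣sum =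
      map residue vs , ones
    , trans (length-map residue vs) ∣vs∣≡∣xs∣ , trans (length-replicate (length vs)) ∣vs∣≡∣xs∣
    , map⁺ (All.map residue≢0 N∤vs) , replicate⁺ (length vs) refl
    , ∣-dot-residue vs xs N∣weightedSum
    , subst (N ∣_) (dot-comm (map residue vs) ones)
        (∣-dot-residue vs ones (subst (N ∣_) (sym (weightedSum-ones vs)) N∣sum))
    where
    ones = replicate (length vs) one

  N∤1 : N ∤ 1
  N∤1 = >⇒∤ (s≤s (s≤s z≤n))

  N∤N-1 : N ∤ suc k
  N∤N-1 = >⇒∤ (n<1+n (suc k))

  wzs-pair : ∀ x → WZS (x ∷ x ∷ [])
  wzs-pair x = wzs-by-residues (1 ∷ suc k ∷ []) (x ∷ x ∷ []) refl (N∤1 ∷ N∤N-1 ∷ [])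
    (divides (toℕ x) (weighted (toℕ x) k)) (divides 1 refl)
    where
    weighted : ∀ X k → 1 * X + (suc k * X + 0) ≡ X * suc (suc k)
    weighted = solve-∀

  wzs-alternating : ∀ x y → WZS (x ∷ y ∷ x ∷ y ∷ [])
  wzs-alternating x y =
    wzs-by-residues (1 ∷ 1 ∷ suc k ∷ suc k ∷ []) (x ∷ y ∷ x ∷ y ∷ []) refl
      (N∤1 ∷ N∤1 ∷ N∤N-1 ∷ N∤N-1 ∷ [])
      (divides (toℕ x + toℕ y) (weighted (toℕ x) (toℕ y) k)) (divides 2 (summed k))
    where
    weighted : ∀ X Y k →
      1 * X + (1 * Y + (suc k * X + (suc k * Y + 0))) ≡ (X + Y) * suc (suc k)
    weighted = solve-∀
    summed : ∀ k → 1 + (1 + (suc k + (suc k + 0))) ≡ 2 * suc (suc k)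
    summed = solve-∀

  wzs-distinct : ∀ x y z → x ≢ y → y ≢ z → x ≢ z → WZS (x ∷ y ∷ z ∷ [])
  -- The weights y − z, z − x, x − y, shifted by N to avoid truncated subtraction.
  wzs-distinct x y z x≢y y≢z x≢z =
    wzs-by-residues (Y + (N ∸ Z) ∷ Z + (N ∸ X) ∷ X + (N ∸ Y) ∷ []) (x ∷ y ∷ z ∷ []) refl
      (nonzero y≢z ∷ nonzero (≢-sym x≢z) ∷ nonzero x≢y ∷ [])
      N∣weightedSum N∣sum
    where
    open ≡-Reasoning
    X = toℕ x
    Y = toℕ y
    Z = toℕ z
    nonzero : ∀ {u v} → u ≢ v → N ∤ toℕ u + (N ∸ toℕ v)
    nonzero {u} {v} u≢v N∣ = u≢v (toℕ-injective (∣+∸⇒≡ (toℕ<n u) (toℕ<n v) N∣))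
    complement : ∀ (u : Fin N) → N ∸ toℕ u + toℕ u ≡ N
    complement u = m∸n+n≡m (<⇒≤ (toℕ<n u))
    cyclic : ∀ X Y Z X′ Y′ Z′ →
      (Y + Z′) * X + ((Z + X′) * Y + ((X + Y′) * Z + 0))
        ≡ (Z′ + Z) * X + ((X′ + X) * Y + (Y′ + Y) * Z)
    cyclic = solve-∀
    cyclic-sum : ∀ X Y Z X′ Y′ Z′ →
      Y + Z′ + (Z + X′ + (X + Y′ + 0)) ≡ (Z′ + Z) + ((X′ + X) + (Y′ + Y))
    cyclic-sum = solve-∀
    N∣weightedSum : N ∣ weightedSum (Y + (N ∸ Z) ∷ Z + (N ∸ X) ∷ X + (N ∸ Y) ∷ []) (x ∷ y ∷ z ∷ [])
    N∣weightedSum = subst (N ∣_) (sym (begin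
      _ ≡⟨ cyclic X Y Z (N ∸ X) (N ∸ Y) (N ∸ Z) ⟩
      (N ∸ Z + Z) * X + ((N ∸ X + X) * Y + (N ∸ Y + Y) * Z)
        ≡⟨ cong₂ _+_ (cong (_* X) (complement z))
             (cong₂ _+_ (cong (_* Y) (complement x)) (cong (_* Z) (complement y))) ⟩
      N * X + (N * Y + N * Z) ∎))
      (∣m∣n⇒∣m+n (m∣m*n X) (∣m∣n⇒∣m+n (m∣m*n Y) (m∣m*n Z)))
    N∣sum : N ∣ sum (Y + (N ∸ Z) ∷ Z + (N ∸ X) ∷ X + (N ∸ Y) ∷ [])
    N∣sum = subst (N ∣_) (sym (begin
      _ ≡⟨ cyclic-sum X Y Z (N ∸ X) (N ∸ Y) (N ∸ Z) ⟩
      (N ∸ Z + Z) + ((N ∸ X + X) + (N ∸ Y + Y))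
        ≡⟨ cong₂ _+_ (complement z) (cong₂ _+_ (complement x) (complement y)) ⟩
      N + (N + N) ∎))
      (∣m∣n⇒∣m+n ∣-refl (∣m∣n⇒∣m+n ∣-refl ∣-refl))

  wzs-block : ∀ pre x blk suf → WZS (x ∷ blk) → HasWZSBlock (pre ++ (x ∷ blk) ++ suf)
  wzs-block pre x blk suf wzs = pre , x ∷ blk , suf , refl , s≤s z≤n , wzs

  length-4-has-WZS-block : Property N (Nonzero N) (One N) 4
  length-4-has-WZS-block (a ∷ b ∷ c ∷ d ∷ []) refl with a ≟ b
  ... | yes refl = wzs-block [] a (a ∷ []) (c ∷ d ∷ []) (wzs-pair a)
  ... | no a≢b with b ≟ c
  ... | yes refl = wzs-block (a ∷ []) b (b ∷ []) (d ∷ []) (wzs-pair b)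
  ... | no b≢c with c ≟ d
  ... | yes refl = wzs-block (a ∷ b ∷ []) c (c ∷ []) [] (wzs-pair c)
  ... | no c≢d with a ≟ c
  ... | no a≢c = wzs-block [] a (b ∷ c ∷ []) (d ∷ []) (wzs-distinct a b c a≢b b≢c a≢c)
  ... | yes refl with b ≟ d
  ... | no b≢d = wzs-block (a ∷ []) b (a ∷ d ∷ []) [] (wzs-distinct b a d b≢c c≢d b≢d)
  ... | yes refl = wzs-block [] a (b ∷ a ∷ b ∷ []) [] (wzs-alternating a b)

  ¬wzs-singleton : ∀ x → ¬ WZS (x ∷ [])
  ¬wzs-singleton x ((a ∷ []) , (b ∷ []) , refl , refl , (a≢0 ∷ []) , (b≡1 ∷ []) , _ , N∣ba) =
    nonzero⇒∤ a≢0 (subst (N ∣_) ba≡a N∣ba)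
    where
    ba≡a : toℕ b * toℕ a + 0 ≡ toℕ a
    ba≡a = trans (+-identityʳ _) (trans (cong (_* toℕ a) b≡1) (*-identityˡ (toℕ a)))

  ¬wzs-01 : ¬ WZS (Fin.zero ∷ one ∷ [])
  ¬wzs-01 ((a ∷ a′ ∷ []) , _ , refl , _ , (_ ∷ a′≢0 ∷ []) , _ , N∣dot , _) =
    nonzero⇒∤ a′≢0 (subst (N ∣_) (dot≡ (toℕ a) (toℕ a′)) N∣dot)
    where
    dot≡ : ∀ u v → u * 0 + (v * 1 + 0) ≡ v
    dot≡ = solve-∀

  ¬wzs-10 : ¬ WZS (one ∷ Fin.zero ∷ [])
  ¬wzs-10 ((a ∷ a′ ∷ []) , _ , refl , _ , (a≢0 ∷ _ ∷ []) , _ , N∣dot , _) =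
    nonzero⇒∤ a≢0 (subst (N ∣_) (dot≡ (toℕ a) (toℕ a′)) N∣dot)
    where
    dot≡ : ∀ u v → u * 1 + (v * 0 + 0) ≡ u
    dot≡ = solve-∀

  ¬wzs-010 : ¬ WZS (Fin.zero ∷ one ∷ Fin.zero ∷ [])
  ¬wzs-010 ((a ∷ a′ ∷ a″ ∷ []) , _ , refl , _ , (_ ∷ a′≢0 ∷ _ ∷ []) , _ , N∣dot , _) =
    nonzero⇒∤ a′≢0 (subst (N ∣_) (dot≡ (toℕ a) (toℕ a′) (toℕ a″)) N∣dot)
    where
    dot≡ : ∀ u v w → u * 0 + (v * 1 + (w * 0 + 0)) ≡ v
    dot≡ = solve-∀

  ¬HasWZSBlock-010 : ¬ HasWZSBlock (Fin.zero ∷ one ∷ Fin.zero ∷ [])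
  ¬HasWZSBlock-010 (_ , [] , _ , _ , () , _)
  ¬HasWZSBlock-010 ([] , x ∷ [] , _ , refl , _ , wzs) = ¬wzs-singleton x wzs
  ¬HasWZSBlock-010 ([] , _ ∷ _ ∷ [] , _ , refl , _ , wzs) = ¬wzs-01 wzs
  ¬HasWZSBlock-010 ([] , _ ∷ _ ∷ _ ∷ [] , _ , refl , _ , wzs) = ¬wzs-010 wzs
  ¬HasWZSBlock-010 (_ ∷ [] , x ∷ [] , _ , refl , _ , wzs) = ¬wzs-singleton x wzs
  ¬HasWZSBlock-010 (_ ∷ [] , _ ∷ _ ∷ [] , _ , refl , _ , wzs) = ¬wzs-10 wzs
  ¬HasWZSBlock-010 (_ ∷ _ ∷ [] , x ∷ [] , _ , refl , _ , wzs) = ¬wzs-singleton x wzs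
  ¬HasWZSBlock-010 (_ ∷ _ ∷ _ ∷ [] , _ ∷ _ , _ , () , _)
  ¬HasWZSBlock-010 (_ ∷ _ ∷ _ ∷ _ ∷ _ , _ ∷ _ , _ , () , _)

  ¬Property<4 : ∀ m → 1 ≤ m → m < 4 → ¬ Property N (Nonzero N) (One N) m
  ¬Property<4 1 _ _ P =
    ¬HasWZSBlock-010 (HasConsecutiveWZS-++ʳ (Fin.zero ∷ []) (one ∷ Fin.zero ∷ []) (P _ refl))
  ¬Property<4 2 _ _ P =
    ¬HasWZSBlock-010 (HasConsecutiveWZS-++ʳ (Fin.zero ∷ one ∷ []) (Fin.zero ∷ []) (P _ refl))
  ¬Property<4 3 _ _ P = ¬HasWZSBlock-010 (P _ refl)
  ¬Property<4 (suc (suc (suc (suc _)))) _ (s≤s (s≤s (s≤s (s≤s ()))))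

theorem6 : (n : ℕ) → 2 ≤ n → IsC n (Nonzero n) (One n) 4
theorem6 (suc (suc k)) (s≤s (s≤s _)) = s≤s z≤n , length-4-has-WZS-block , ¬Property<4
  where open ZeroSumBlocks k
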